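{- Let $q$ be a prime power, $f\in\mathbb{F}_q[t]$ monic of degree $k$, $1\leq m<k$, $I=I(f,m)$, and $d\mid k$ with $d>1$. Then the set $I^{1/d}=\{g\in\mathbb{F}_q[t] \text{ monic of degree } k/d : g^d\in I\}$ has at most $q^m$ elements.
   Context: $I(f,m)=\{f+h: h\in\mathbb{F}_q[t],\ \deg h\leq m\}$. -}

module Defs where

open import Level using (0ℓ)
open import Data.Nat using (ℕ; zero; suc; _<_)
open import Data.Fin using (Fin)
open import Data.List using (List; []; _∷_; map)
open import Data.Product using (Σ; ∃; _×_)
open import Relation.Nullary using (¬_)
open import Relation.Binary.PropositionalEquality using (_≡_)
open import Algebra.Structures using (IsCommutativeRing)
open import Function.Bundles using (_↔_)

-- A finite field with q elements (q is then automatically a prime power).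
-- Equality of field elements is propositional equality.
record FiniteField : Set₁ where
  infixl 6 _+_
  infixl 7 _*_
  field
    Carrier   : Set
    _+_ _*_   : Carrier → Carrier → Carrier
    -_        : Carrier → Carrier
    0# 1#     : Carrier
    isCommutativeRing : IsCommutativeRing _≡_ _+_ _*_ -_ 0# 1#
    0≢1       : ¬ (0# ≡ 1#)
    inverse   : ∀ x → ¬ (x ≡ 0#) → ∃ λ y → x * y ≡ 1#
    size      : ℕ
    enumeration : Carrier ↔ Fin size

-- Polynomials over F: lists of coefficients, constant term first.
-- Two lists denote the same polynomial iff all coefficients agree
-- (trailing zeros are irrelevant).
module Poly (F : FiniteField) where
  open FiniteField F

  Pol : Set
  Pol = List Carrier

  coeff : Pol → ℕ → Carrier
  coeff []       _       = 0#
  coeff (a ∷ p)  zero    = a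
  coeff (a ∷ p)  (suc j) = coeff p j

  _≈ₚ_ : Pol → Pol → Set
  p ≈ₚ r = ∀ j → coeff p j ≡ coeff r j

  _+ₚ_ : Pol → Pol → Pol
  []      +ₚ r       = r
  (a ∷ p) +ₚ []      = a ∷ p
  (a ∷ p) +ₚ (b ∷ r) = (a + b) ∷ (p +ₚ r)

  _*ₚ_ : Pol → Pol → Pol
  []      *ₚ r = []
  (a ∷ p) *ₚ r = map (a *_) r +ₚ (0# ∷ (p *ₚ r))

  _^ₚ_ : Pol → ℕ → Pol
  p ^ₚ zero  = 1# ∷ []
  p ^ₚ suc n = p *ₚ (p ^ₚ n)

  -- deg p ≤ m  (the zero polynomial has degree -∞ ≤ m)
  DegLe : Pol → ℕ → Set
  DegLe p m = ∀ j → m < j → coeff p j ≡ 0#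

  MonicOfDeg : Pol → ℕ → Set
  MonicOfDeg p n = coeff p n ≡ 1# × DegLe p n

  InI : Pol → ℕ → Pol → Set
  InI f m p = Σ Pol λ h → DegLe h m × (p ≈ₚ (f +ₚ h))

-- The bound follows from a uniqueness statement: two monic g, h of the same
-- degree n with g^d, h^d ∈ I(f,m) and the same coefficients in degrees < m are
-- equal.  Granting this, the map sending g to its first m coefficients is
-- injective on I(f,m)^{1/d}, and lands in a set of size q^m (pigeonhole).
--
-- Suppose g ≠ h and let u = g - h, of exact degree e with
-- leading coefficient a ≠ 0; then m ≤ e < n.  Let s+1 be the least positive
-- index with C(d,s+1) ≠ 0 in F (it exists as C(d,d) = 1).  By the binomial
-- theorem g^d = Σᵢ C(d,i) uⁱ h^{d-i}, and the i-th term has degree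
-- ≤ w(i) = i·e + (d-i)·n, a strictly decreasing function of i.  So at degree
-- N = w(s+1) the terms 0 < i < s+1 vanish (binomial coefficient 0), the terms
-- i > s+1 vanish (degree too small), and g^d and h^d differ there by
-- C(d,s+1)·a^{s+1} ≠ 0.  Since d ≥ 2 we get N ≥ w(d) = d·e > m, contradicting
-- that g^d and h^d agree in all degrees > m.
module Submission where

open import Defs
open import Level using (0ℓ)
open import Data.Nat using (ℕ; zero; suc; _≤_; _<_; _^_; _∸_; z≤n; s≤s; z<s; s≤s⁻¹)
import Data.Nat as ℕ
open import Data.Nat.Properties
  using (≮⇒≥; m≤n⇒m<n∨m≡n; <-cmp; <-trans; <⇒≤; <-≤-trans; ≤-trans; ≤-refl;
         +-monoʳ-<; +-monoˡ-<; m<m+n; *-monoˡ-≤; n∸n≡0; +-∸-assoc)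
import Data.Nat.Properties as ℕₚ
open import Data.Nat.Divisibility using (_∣_)
open import Data.Nat.Combinatorics using (_C_; nCn≡1)
open import Data.Fin using (Fin; toℕ; fromℕ<; funToFin; finToFun)
import Data.Fin as Fin
open import Data.Fin.Properties using (pigeonhole; finToFun-funToFin; toℕ-fromℕ<)
import Data.Fin.Properties as Fin
open import Data.List using (List; []; _∷_; length; lookup; map)
open import Data.List.Relation.Unary.All using (All; []; _∷_)
open import Data.List.Relation.Unary.AllPairs using (AllPairs; []; _∷_)
open import Data.Product using (Σ; _×_; _,_; proj₁; proj₂)
open import Data.Sum using (inj₁; inj₂)
open import Data.Empty using (⊥-elim)
open import Function using (_∘_)
open import Function.Bundles using (Inverse)
open import Function.Properties.Inverse using (↔⇒↣)
open import Relation.Nullary using (¬_; Dec; yes; no)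
open import Relation.Nullary.Decidable using (via-injection; decidable-stable; ¬?)
open import Relation.Unary using (Decidable)
open import Relation.Binary.Definitions using (tri<; tri≈; tri>)
open import Relation.Binary.Structures using (IsEquivalence)
open import Relation.Binary.PropositionalEquality
open import Algebra.Bundles using (CommutativeRing; CommutativeSemiring; Semiring)
import Algebra.Structures.Biased as Biased


least : (P : ℕ → Set) → Decidable P → ∀ {k} → P k →
        Σ ℕ λ i → P i × i ≤ k × (∀ j → j < i → ¬ P j)
least P P? {zero} pk = 0 , pk , z≤n , λ _ ()
least P P? {suc k} pk with P? 0
... | yes p0 = 0 , p0 , z≤n , λ _ ()
... | no ¬p0 with least (P ∘ suc) (P? ∘ suc) pk
...   | i , pi , i≤k , below = suc i , pi , s≤s i≤k , below′
  where
  below′ : ∀ j → j < suc i → ¬ P j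
  below′ zero    _   = ¬p0
  below′ (suc j) j<i = below j (s≤s⁻¹ j<i)

greatest : (P : ℕ → Set) → Decidable P → ∀ B → (∀ i → B < i → ¬ P i) → ∀ {j} → P j →
           Σ ℕ λ e → P e × j ≤ e × (∀ i → e < i → ¬ P i)
greatest P P? zero above {zero}  pj = 0 , pj , z≤n , above
greatest P P? zero above {suc j} pj = ⊥-elim (above (suc j) z<s pj)
greatest P P? (suc B) above pj with P? (suc B)
... | yes pB = suc B , pB , ≮⇒≥ (λ B<j → above _ B<j pj) , above
... | no ¬pB = greatest P P? B above′ pj
  where
  above′ : ∀ i → B < i → ¬ P i
  above′ i B<i with m≤n⇒m<n∨m≡n B<i
  ... | inj₁ sB<i = above i sB<i
  ... | inj₂ refl = ¬pB


-- weight D e n i bounds the degree of uⁱ·y^{D-i} when deg u ≤ e, deg y ≤ n.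
weight : ℕ → ℕ → ℕ → ℕ → ℕ
weight D e n i = i ℕ.* e ℕ.+ (D ∸ i) ℕ.* n

-- Trading one factor of degree n for one of smaller degree e lowers the weight.
weight-step : ∀ {D e n i} → e < n → i < D → weight D e n (suc i) < weight D e n i
weight-step {D} {e} {n} {i} e<n i<D = begin-strict
  (e ℕ.+ i ℕ.* e) ℕ.+ k ℕ.* n    ≡⟨ ℕₚ.+-assoc e (i ℕ.* e) (k ℕ.* n) ⟩
  e ℕ.+ (i ℕ.* e ℕ.+ k ℕ.* n)    ≡⟨ left-comm e (i ℕ.* e) (k ℕ.* n) ⟩
  i ℕ.* e ℕ.+ (e ℕ.+ k ℕ.* n)    <⟨ +-monoʳ-< (i ℕ.* e) (+-monoˡ-< (k ℕ.* n) e<n) ⟩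
  i ℕ.* e ℕ.+ suc k ℕ.* n        ≡⟨ cong (λ z → i ℕ.* e ℕ.+ z ℕ.* n) (+-∸-assoc 1 i<D) ⟨
  weight D e n i                  ∎
  where
  open ℕₚ.≤-Reasoning
  k = D ∸ suc i
  left-comm : ∀ a b c → a ℕ.+ (b ℕ.+ c) ≡ b ℕ.+ (a ℕ.+ c)
  left-comm a b c = trans (sym (ℕₚ.+-assoc a b c))
                          (trans (cong (ℕ._+ c) (ℕₚ.+-comm a b)) (ℕₚ.+-assoc b a c))

weight-decreasing : ∀ {D e n a b} → e < n → a < b → b ≤ D → weight D e n b < weight D e n a
weight-decreasing {b = suc b} e<n (s≤s a≤b) b<D with m≤n⇒m<n∨m≡n a≤b
... | inj₁ a<b  = <-trans (weight-step e<n b<D) (weight-decreasing e<n a<b (<⇒≤ b<D))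
... | inj₂ refl = weight-step e<n b<D

-- For D ≥ 2 and 1 ≤ m ≤ e < n every weight on [0, D] exceeds m, as
-- weight D = D·e ≥ 2e > e ≥ m.
weight-exceeds : ∀ {D e n m a} → 1 ≤ m → m ≤ e → e < n → 2 ≤ D → a ≤ D →
                 m < weight D e n a
weight-exceeds {D} {e} {n} {m} {a} 1≤m m≤e e<n 2≤D a≤D =
  <-≤-trans m<weightD weightD≤weighta
  where
  open ℕₚ.≤-Reasoning
  m<weightD : m < weight D e n D
  m<weightD = begin-strict
    m                           ≤⟨ m≤e ⟩
    e                           <⟨ m<m+n e (≤-trans 1≤m m≤e) ⟩
    e ℕ.+ e                     ≡⟨ cong (e ℕ.+_) (ℕₚ.+-comm 0 e) ⟩
    2 ℕ.* e                     ≤⟨ *-monoˡ-≤ e 2≤D ⟩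
    D ℕ.* e                     ≡⟨ ℕₚ.+-comm 0 (D ℕ.* e) ⟩
    D ℕ.* e ℕ.+ 0 ℕ.* n         ≡⟨ cong (λ z → D ℕ.* e ℕ.+ z ℕ.* n) (n∸n≡0 D) ⟨
    weight D e n D              ∎
  weightD≤weighta : weight D e n D ≤ weight D e n a
  weightD≤weighta with m≤n⇒m<n∨m≡n a≤D
  ... | inj₁ a<D  = <⇒≤ (weight-decreasing e<n a<D ≤-refl)
  ... | inj₂ refl = ≤-refl


all-lookup : ∀ {A : Set} {P : A → Set} {xs : List A} → All P xs → ∀ i → P (lookup xs i)
all-lookup (px ∷ _)   Fin.zero    = px
all-lookup (_  ∷ pxs) (Fin.suc i) = all-lookup pxs i

allPairs-lookup : ∀ {A : Set} {R : A → A → Set} {xs : List A} → AllPairs R xs →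
                  ∀ i j → i Fin.< j → R (lookup xs i) (lookup xs j)
allPairs-lookup (rx ∷ _)  Fin.zero    (Fin.suc j) _         = all-lookup rx j
allPairs-lookup (_  ∷ rs) (Fin.suc i) (Fin.suc j) (s≤s i<j) = allPairs-lookup rs i j i<j

boundedByKeys : ∀ {A : Set} {P : A → Set} {R : A → A → Set} {K} (key : A → Fin K) →
                (∀ {a b} → P a → P b → key a ≡ key b → ¬ R a b) →
                ∀ {xs} → All P xs → AllPairs R xs → length xs ≤ K
boundedByKeys key separates {xs} ps rs = ≮⇒≥ λ K<len →
  let (i , j , i<j , same) = pigeonhole K<len (key ∘ lookup xs)
  in separates (all-lookup ps i) (all-lookup ps j) same (allPairs-lookup rs i j i<j)


module FieldFacts (F : FiniteField) where
  open FiniteField F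

  ring : CommutativeRing 0ℓ 0ℓ
  ring = record { isCommutativeRing = isCommutativeRing }

  open CommutativeRing ring public
    using (+-assoc; +-comm; +-identityˡ; +-identityʳ; *-assoc; *-comm;
           *-identityˡ; distribˡ; distribʳ; zeroˡ; zeroʳ; -‿inverseˡ)
  open import Algebra.Properties.Ring (CommutativeRing.ring ring) public
    using (-0#≈0#)
  open import Algebra.Properties.AbelianGroup (CommutativeRing.+-abelianGroup ring) public
    using (identityʳ-unique; x∙y⁻¹≈ε⇒x≈y; x≈y⇒x∙y⁻¹≈ε)
  open import Algebra.Properties.CommutativeSemigroup
    (CommutativeRing.+-commutativeSemigroup ring) public
    using (interchange; x∙yz≈y∙xz)
  open import Algebra.Definitions.RawSemiring (Semiring.rawSemiring (CommutativeRing.semiring ring)) public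
    using () renaming (_×_ to _×ᶠ_; sum to sumᶠ; _^_ to _^ᶠ_)
  open import Algebra.Properties.Semiring.Mult (CommutativeRing.semiring ring)
    using (×-assoc-*)
  open ≡-Reasoning

  infix 4 _≟_
  _≟_ : (a b : Carrier) → Dec (a ≡ b)
  _≟_ = via-injection (↔⇒↣ enumeration) Fin._≟_

  *-nonzero : ∀ {a b} → ¬ a ≡ 0# → ¬ b ≡ 0# → ¬ a * b ≡ 0#
  *-nonzero {a} {b} a≢0 b≢0 ab≡0 with inverse a a≢0
  ... | a⁻¹ , aa⁻¹≡1 = b≢0 (begin
    b              ≡⟨ *-identityˡ b ⟨
    1# * b         ≡⟨ cong (_* b) (trans (sym aa⁻¹≡1) (*-comm a a⁻¹)) ⟩
    (a⁻¹ * a) * b  ≡⟨ *-assoc a⁻¹ a b ⟩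
    a⁻¹ * (a * b)  ≡⟨ cong (a⁻¹ *_) ab≡0 ⟩
    a⁻¹ * 0#       ≡⟨ zeroʳ a⁻¹ ⟩
    0#             ∎)

  ^-nonzero : ∀ {a} i → ¬ a ≡ 0# → ¬ a ^ᶠ i ≡ 0#
  ^-nonzero zero    a≢0 1≡0 = 0≢1 (sym 1≡0)
  ^-nonzero (suc i) a≢0     = *-nonzero a≢0 (^-nonzero i a≢0)

  ×-as-* : ∀ c w → c ×ᶠ w ≡ (c ×ᶠ 1#) * w
  ×-as-* c w = sym (trans (×-assoc-* c 1# w) (cong (c ×ᶠ_) (*-identityˡ w)))

  sum-vanishing : ∀ n (f : ℕ → Carrier) → (∀ i → i < n → f i ≡ 0#) → sumᶠ {n} (f ∘ toℕ) ≡ 0#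
  sum-vanishing zero    f vanish = refl
  sum-vanishing (suc n) f vanish =
    trans (cong₂ _+_ (vanish 0 z<s) (sum-vanishing n (f ∘ suc) (λ i i<n → vanish (suc i) (s≤s i<n))))
          (+-identityˡ 0#)

  sum-concentrated : ∀ n (f : ℕ → Carrier) s → s < n → (∀ i → i < n → ¬ i ≡ s → f i ≡ 0#) →
                     sumᶠ {n} (f ∘ toℕ) ≡ f s
  sum-concentrated (suc n) f zero    _         vanish =
    trans (cong (f 0 +_) (sum-vanishing n (f ∘ suc) (λ i i<n → vanish (suc i) (s≤s i<n) λ ())))
          (+-identityʳ (f 0))
  sum-concentrated (suc n) f (suc s) (s≤s s<n) vanish =
    trans (cong₂ _+_ (vanish 0 z<s λ ())
                     (sum-concentrated n (f ∘ suc) s s<n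
                        (λ i i<n i≢s → vanish (suc i) (s≤s i<n) (i≢s ∘ ℕₚ.suc-injective))))
          (+-identityˡ (f (suc s)))


module PolynomialSemiring (F : FiniteField) where
  open FiniteField F
  open FieldFacts F
  open Poly F
  open ≡-Reasoning

  coeff-+ : ∀ p r j → coeff (p +ₚ r) j ≡ coeff p j + coeff r j
  coeff-+ []      r       j       = sym (+-identityˡ _)
  coeff-+ (a ∷ p) []      j       = sym (+-identityʳ _)
  coeff-+ (a ∷ p) (b ∷ r) zero    = refl
  coeff-+ (a ∷ p) (b ∷ r) (suc j) = coeff-+ p r j

  coeff-scale : ∀ a r j → coeff (map (a *_) r) j ≡ a * coeff r j
  coeff-scale a []      j       = sym (zeroʳ a)
  coeff-scale a (b ∷ r) zero    = refl
  coeff-scale a (b ∷ r) (suc j) = coeff-scale a r j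

  coeff-neg : ∀ r j → coeff (map -_ r) j ≡ - coeff r j
  coeff-neg []      j       = sym -0#≈0#
  coeff-neg (b ∷ r) zero    = refl
  coeff-neg (b ∷ r) (suc j) = coeff-neg r j

  coeff-scale-shift : ∀ a r s j → coeff (map (a *_) r +ₚ (0# ∷ s)) j ≡ a * coeff r j + coeff (0# ∷ s) j
  coeff-scale-shift a r s j =
    trans (coeff-+ (map (a *_) r) (0# ∷ s) j) (cong (_+ coeff (0# ∷ s) j) (coeff-scale a r j))

  coeff-*-cons : ∀ a p r j → coeff ((a ∷ p) *ₚ r) j ≡ a * coeff r j + coeff (0# ∷ (p *ₚ r)) j
  coeff-*-cons a p r = coeff-scale-shift a r (p *ₚ r)

  ≈-refl : ∀ {p} → p ≈ₚ p
  ≈-refl j = refl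

  ≈-sym : ∀ {p r} → p ≈ₚ r → r ≈ₚ p
  ≈-sym e j = sym (e j)

  ≈-trans : ∀ {p r s} → p ≈ₚ r → r ≈ₚ s → p ≈ₚ s
  ≈-trans e e′ j = trans (e j) (e′ j)

  ∷-cong : ∀ a {s s′} → s ≈ₚ s′ → (a ∷ s) ≈ₚ (a ∷ s′)
  ∷-cong a e zero    = refl
  ∷-cong a e (suc j) = e j

  shift-+ : ∀ s t j → coeff (0# ∷ (s +ₚ t)) j ≡ coeff (0# ∷ s) j + coeff (0# ∷ t) j
  shift-+ s t zero    = sym (+-identityˡ 0#)
  shift-+ s t (suc j) = coeff-+ s t j

  +-cong : ∀ {p p′ r r′} → p ≈ₚ p′ → r ≈ₚ r′ → (p +ₚ r) ≈ₚ (p′ +ₚ r′)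
  +-cong {p} {p′} {r} {r′} e e′ j =
    trans (coeff-+ p r j) (trans (cong₂ _+_ (e j) (e′ j)) (sym (coeff-+ p′ r′ j)))

  +ₚ-assoc : ∀ p r s → ((p +ₚ r) +ₚ s) ≈ₚ (p +ₚ (r +ₚ s))
  +ₚ-assoc p r s j = begin
    coeff ((p +ₚ r) +ₚ s) j               ≡⟨ coeff-+ (p +ₚ r) s j ⟩
    coeff (p +ₚ r) j + coeff s j          ≡⟨ cong (_+ coeff s j) (coeff-+ p r j) ⟩
    (coeff p j + coeff r j) + coeff s j   ≡⟨ +-assoc _ _ _ ⟩
    coeff p j + (coeff r j + coeff s j)   ≡⟨ cong (coeff p j +_) (coeff-+ r s j) ⟨
    coeff p j + coeff (r +ₚ s) j          ≡⟨ coeff-+ p (r +ₚ s) j ⟨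
    coeff (p +ₚ (r +ₚ s)) j               ∎

  +ₚ-comm : ∀ p r → (p +ₚ r) ≈ₚ (r +ₚ p)
  +ₚ-comm p r j = trans (coeff-+ p r j) (trans (+-comm _ _) (sym (coeff-+ r p j)))

  *-congʳ : ∀ p {r r′} → r ≈ₚ r′ → (p *ₚ r) ≈ₚ (p *ₚ r′)
  *-congʳ []      e j = refl
  *-congʳ (a ∷ p) {r} {r′} e j = begin
    coeff ((a ∷ p) *ₚ r) j                       ≡⟨ coeff-*-cons a p r j ⟩
    a * coeff r j + coeff (0# ∷ (p *ₚ r)) j      ≡⟨ cong₂ (λ c c′ → a * c + c′) (e j)
                                                      (∷-cong 0# (*-congʳ p e) j) ⟩
    a * coeff r′ j + coeff (0# ∷ (p *ₚ r′)) j    ≡⟨ coeff-*-cons a p r′ j ⟨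
    coeff ((a ∷ p) *ₚ r′) j                      ∎

  distribʳₚ : ∀ r p q → ((p +ₚ q) *ₚ r) ≈ₚ ((p *ₚ r) +ₚ (q *ₚ r))
  distribʳₚ r []      q       j = refl
  distribʳₚ r (a ∷ p) []      j = sym (trans (coeff-+ ((a ∷ p) *ₚ r) [] j) (+-identityʳ _))
  distribʳₚ r (a ∷ p) (b ∷ q) j = begin
    coeff (((a + b) ∷ (p +ₚ q)) *ₚ r) j
      ≡⟨ coeff-*-cons (a + b) (p +ₚ q) r j ⟩
    (a + b) * coeff r j + coeff (0# ∷ ((p +ₚ q) *ₚ r)) j
      ≡⟨ cong₂ _+_ (distribʳ (coeff r j) a b)
                   (trans (∷-cong 0# (distribʳₚ r p q) j) (shift-+ (p *ₚ r) (q *ₚ r) j)) ⟩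
    (a * coeff r j + b * coeff r j) + (coeff (0# ∷ (p *ₚ r)) j + coeff (0# ∷ (q *ₚ r)) j)
      ≡⟨ interchange _ _ _ _ ⟩
    (a * coeff r j + coeff (0# ∷ (p *ₚ r)) j) + (b * coeff r j + coeff (0# ∷ (q *ₚ r)) j)
      ≡⟨ cong₂ _+_ (coeff-*-cons a p r j) (coeff-*-cons b q r j) ⟨
    coeff ((a ∷ p) *ₚ r) j + coeff ((b ∷ q) *ₚ r) j
      ≡⟨ coeff-+ ((a ∷ p) *ₚ r) ((b ∷ q) *ₚ r) j ⟨
    coeff (((a ∷ p) *ₚ r) +ₚ ((b ∷ q) *ₚ r)) j ∎

  *-identityˡₚ : ∀ r → ((1# ∷ []) *ₚ r) ≈ₚ r
  *-identityˡₚ r j = begin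
    coeff ((1# ∷ []) *ₚ r) j             ≡⟨ coeff-*-cons 1# [] r j ⟩
    1# * coeff r j + coeff (0# ∷ []) j   ≡⟨ cong₂ _+_ (*-identityˡ _) (empty j) ⟩
    coeff r j + 0#                       ≡⟨ +-identityʳ _ ⟩
    coeff r j                            ∎
    where
    empty : ∀ j → coeff (0# ∷ []) j ≡ 0#
    empty zero    = refl
    empty (suc j) = refl

  *-consʳ : ∀ p b r → (p *ₚ (b ∷ r)) ≈ₚ (map (b *_) p +ₚ (0# ∷ (p *ₚ r)))
  *-consʳ []      b r zero    = refl
  *-consʳ []      b r (suc j) = refl
  *-consʳ (a ∷ p) b r zero    = cong (_+ 0#) (*-comm a b)
  *-consʳ (a ∷ p) b r (suc j) = begin
    coeff ((a ∷ p) *ₚ (b ∷ r)) (suc j)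
      ≡⟨ coeff-*-cons a p (b ∷ r) (suc j) ⟩
    a * coeff r j + coeff (p *ₚ (b ∷ r)) j
      ≡⟨ cong (a * coeff r j +_) (*-consʳ p b r j) ⟩
    a * coeff r j + coeff (map (b *_) p +ₚ (0# ∷ (p *ₚ r))) j
      ≡⟨ cong (a * coeff r j +_) (coeff-scale-shift b p (p *ₚ r) j) ⟩
    a * coeff r j + (b * coeff p j + coeff (0# ∷ (p *ₚ r)) j)
      ≡⟨ x∙yz≈y∙xz _ _ _ ⟩
    b * coeff p j + (a * coeff r j + coeff (0# ∷ (p *ₚ r)) j)
      ≡⟨ cong₂ _+_ (coeff-scale b p j) (coeff-*-cons a p r j) ⟨
    coeff (map (b *_) p) j + coeff ((a ∷ p) *ₚ r) j
      ≡⟨ coeff-+ (map (b *_) p) ((a ∷ p) *ₚ r) j ⟨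
    coeff (map (b *_) p +ₚ ((a ∷ p) *ₚ r)) j ∎

  *-nilʳ : ∀ p → (p *ₚ []) ≈ₚ []
  *-nilʳ []      j       = refl
  *-nilʳ (a ∷ p) zero    = refl
  *-nilʳ (a ∷ p) (suc j) = *-nilʳ p j

  *ₚ-comm : ∀ p r → (p *ₚ r) ≈ₚ (r *ₚ p)
  *ₚ-comm []      []      j = refl
  *ₚ-comm []      (b ∷ r) j = sym (*-nilʳ (b ∷ r) j)
  *ₚ-comm (a ∷ p) r j = begin
    coeff ((a ∷ p) *ₚ r) j                       ≡⟨ coeff-*-cons a p r j ⟩
    a * coeff r j + coeff (0# ∷ (p *ₚ r)) j      ≡⟨ cong (a * coeff r j +_) (∷-cong 0# (*ₚ-comm p r) j) ⟩
    a * coeff r j + coeff (0# ∷ (r *ₚ p)) j      ≡⟨ coeff-scale-shift a r (r *ₚ p) j ⟨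
    coeff (map (a *_) r +ₚ (0# ∷ (r *ₚ p))) j    ≡⟨ *-consʳ r a p j ⟨
    coeff (r *ₚ (a ∷ p)) j                       ∎

  *-congˡ : ∀ {p p′} r → p ≈ₚ p′ → (p *ₚ r) ≈ₚ (p′ *ₚ r)
  *-congˡ {p} {p′} r e j =
    trans (*ₚ-comm p r j) (trans (*-congʳ r e j) (*ₚ-comm r p′ j))

  scale-*-assoc : ∀ a q r → (map (a *_) q *ₚ r) ≈ₚ map (a *_) (q *ₚ r)
  scale-*-assoc a []      r j = refl
  scale-*-assoc a (b ∷ q) r j = begin
    coeff (((a * b) ∷ map (a *_) q) *ₚ r) j
      ≡⟨ coeff-*-cons (a * b) (map (a *_) q) r j ⟩
    (a * b) * coeff r j + coeff (0# ∷ (map (a *_) q *ₚ r)) j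
      ≡⟨ cong₂ _+_ (*-assoc a b _) (trans (∷-cong 0# (scale-*-assoc a q r) j) (shifted j)) ⟩
    a * (b * coeff r j) + a * coeff (0# ∷ (q *ₚ r)) j
      ≡⟨ distribˡ a _ _ ⟨
    a * (b * coeff r j + coeff (0# ∷ (q *ₚ r)) j)
      ≡⟨ cong (a *_) (coeff-*-cons b q r j) ⟨
    a * coeff ((b ∷ q) *ₚ r) j
      ≡⟨ coeff-scale a ((b ∷ q) *ₚ r) j ⟨
    coeff (map (a *_) ((b ∷ q) *ₚ r)) j ∎
    where
    shifted : ∀ j → coeff (0# ∷ map (a *_) (q *ₚ r)) j ≡ a * coeff (0# ∷ (q *ₚ r)) j
    shifted zero    = sym (zeroʳ a)
    shifted (suc j) = coeff-scale a (q *ₚ r) j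

  shift-*ˡ : ∀ s r → ((0# ∷ s) *ₚ r) ≈ₚ (0# ∷ (s *ₚ r))
  shift-*ˡ s r j = trans (coeff-*-cons 0# s r j)
                         (trans (cong (_+ coeff (0# ∷ (s *ₚ r)) j) (zeroˡ _)) (+-identityˡ _))

  *ₚ-assoc : ∀ p q r → ((p *ₚ q) *ₚ r) ≈ₚ (p *ₚ (q *ₚ r))
  *ₚ-assoc []      q r j = refl
  *ₚ-assoc (a ∷ p) q r j = begin
    coeff (((a ∷ p) *ₚ q) *ₚ r) j
      ≡⟨ distribʳₚ r (map (a *_) q) (0# ∷ (p *ₚ q)) j ⟩
    coeff ((map (a *_) q *ₚ r) +ₚ ((0# ∷ (p *ₚ q)) *ₚ r)) j
      ≡⟨ coeff-+ (map (a *_) q *ₚ r) ((0# ∷ (p *ₚ q)) *ₚ r) j ⟩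
    coeff (map (a *_) q *ₚ r) j + coeff ((0# ∷ (p *ₚ q)) *ₚ r) j
      ≡⟨ cong₂ _+_ (scale-*-assoc a q r j)
                   (trans (shift-*ˡ (p *ₚ q) r j) (∷-cong 0# (*ₚ-assoc p q r) j)) ⟩
    coeff (map (a *_) (q *ₚ r)) j + coeff (0# ∷ (p *ₚ (q *ₚ r))) j
      ≡⟨ coeff-+ (map (a *_) (q *ₚ r)) (0# ∷ (p *ₚ (q *ₚ r))) j ⟨
    coeff ((a ∷ p) *ₚ (q *ₚ r)) j ∎

  polynomialSemiring : CommutativeSemiring 0ℓ 0ℓ
  polynomialSemiring = record
    { Carrier = Pol ; _≈_ = _≈ₚ_ ; _+_ = _+ₚ_ ; _*_ = _*ₚ_ ; 0# = [] ; 1# = 1# ∷ []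
    ; isCommutativeSemiring = Biased.isCommutativeSemiringˡ record
      { +-isCommutativeMonoid = Biased.isCommutativeMonoidˡ record
        { isSemigroup = record
          { isMagma = record
            { isEquivalence = ≈-isEquivalence
            ; ∙-cong = λ {p} {p′} {r} {r′} → +-cong {p} {p′} {r} {r′} }
          ; assoc = +ₚ-assoc }
        ; identityˡ = λ p → ≈-refl {p}
        ; comm = +ₚ-comm }
      ; *-isCommutativeMonoid = Biased.isCommutativeMonoidˡ record
        { isSemigroup = record
          { isMagma = record
            { isEquivalence = ≈-isEquivalence
            ; ∙-cong = λ {p} {p′} {r} {r′} e e′ j → trans (*-congˡ {p} {p′} r e j) (*-congʳ p′ {r} {r′} e′ j) }
          ; assoc = *ₚ-assoc }
        ; identityˡ = *-identityˡₚ
        ; comm = *ₚ-comm }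
      ; distribʳ = distribʳₚ
      ; zeroˡ = λ p → ≈-refl {[]} }
    }
    where
    ≈-isEquivalence : IsEquivalence _≈ₚ_
    ≈-isEquivalence = record
      { refl = λ {p} → ≈-refl {p}
      ; sym = λ {p} {r} → ≈-sym {p} {r}
      ; trans = λ {p} {r} {s} → ≈-trans {p} {r} {s} }


module Degrees (F : FiniteField) where
  open FiniteField F
  open FieldFacts F
  open Poly F
  open PolynomialSemiring F
  open import Algebra.Definitions.RawSemiring (CommutativeSemiring.rawSemiring polynomialSemiring)
    public using () renaming (_^_ to _^ˢ_)
  open ≡-Reasoning

  ^ₚ-is-^ˢ : ∀ p d → p ^ₚ d ≡ p ^ˢ d
  ^ₚ-is-^ˢ p zero    = refl
  ^ₚ-is-^ˢ p (suc d) = cong (p *ₚ_) (^ₚ-is-^ˢ p d)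

  tail-degree : ∀ {a p N} → DegLe (a ∷ p) (suc N) → DegLe p N
  tail-degree deg i N<i = deg (suc i) (s≤s N<i)

  shift-vanishes : ∀ {a p} r → DegLe (a ∷ p) 0 → ∀ j → coeff (0# ∷ (p *ₚ r)) j ≡ 0#
  shift-vanishes     r deg zero    = refl
  shift-vanishes {p = p} r deg (suc j) = *-congˡ {p} {[]} r (λ i → deg (suc i) z<s) j

  *-degree : ∀ p r {N M} → DegLe p N → DegLe r M → DegLe (p *ₚ r) (N ℕ.+ M)
  *-degree []      r dp dr j _ = refl
  *-degree (a ∷ p) r {zero} dp dr j M<j = begin
    coeff ((a ∷ p) *ₚ r) j                   ≡⟨ coeff-*-cons a p r j ⟩
    a * coeff r j + coeff (0# ∷ (p *ₚ r)) j  ≡⟨ cong₂ _+_ (cong (a *_) (dr j M<j)) (shift-vanishes r dp j) ⟩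
    a * 0# + 0#                              ≡⟨ trans (+-identityʳ _) (zeroʳ a) ⟩
    0#                                       ∎
  *-degree (a ∷ p) r {suc N} dp dr zero    ()
  *-degree (a ∷ p) r {suc N} {M} dp dr (suc j) (s≤s N+M<j) = begin
    coeff ((a ∷ p) *ₚ r) (suc j)             ≡⟨ coeff-*-cons a p r (suc j) ⟩
    a * coeff r (suc j) + coeff (p *ₚ r) j   ≡⟨ cong₂ _+_ (cong (a *_) (dr (suc j) M<1+j))
                                                          (*-degree p r (tail-degree dp) dr j N+M<j) ⟩
    a * 0# + 0#                              ≡⟨ trans (+-identityʳ _) (zeroʳ a) ⟩
    0#                                       ∎
    where
    M<1+j : M < suc j
    M<1+j = s≤s (≤-trans (ℕₚ.m≤n+m M N) (<⇒≤ N+M<j))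

  *-top : ∀ p r {N M} → DegLe p N → DegLe r M → coeff (p *ₚ r) (N ℕ.+ M) ≡ coeff p N * coeff r M
  *-top []      r dp dr = sym (zeroˡ _)
  *-top (a ∷ p) r {zero} {M} dp dr = begin
    coeff ((a ∷ p) *ₚ r) M                   ≡⟨ coeff-*-cons a p r M ⟩
    a * coeff r M + coeff (0# ∷ (p *ₚ r)) M  ≡⟨ cong (a * coeff r M +_) (shift-vanishes r dp M) ⟩
    a * coeff r M + 0#                       ≡⟨ +-identityʳ _ ⟩
    a * coeff r M                            ∎
  *-top (a ∷ p) r {suc N} {M} dp dr = begin
    coeff ((a ∷ p) *ₚ r) (suc (N ℕ.+ M))
      ≡⟨ coeff-*-cons a p r (suc (N ℕ.+ M)) ⟩
    a * coeff r (suc (N ℕ.+ M)) + coeff (p *ₚ r) (N ℕ.+ M)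
      ≡⟨ cong₂ _+_ (cong (a *_) (dr _ (s≤s (ℕₚ.m≤n+m M N)))) (*-top p r (tail-degree dp) dr) ⟩
    a * 0# + coeff p N * coeff r M
      ≡⟨ cong (_+ coeff p N * coeff r M) (zeroʳ a) ⟩
    0# + coeff p N * coeff r M
      ≡⟨ +-identityˡ _ ⟩
    coeff p N * coeff r M ∎

  ^-degree : ∀ p {e} i → DegLe p e → DegLe (p ^ˢ i) (i ℕ.* e)
  ^-degree p zero    dp zero    ()
  ^-degree p zero    dp (suc j) _ = refl
  ^-degree p (suc i) dp = *-degree p (p ^ˢ i) dp (^-degree p i dp)

  ^-top : ∀ p {e} i → DegLe p e → coeff (p ^ˢ i) (i ℕ.* e) ≡ coeff p e ^ᶠ i
  ^-top p zero    dp = refl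
  ^-top p {e} (suc i) dp =
    trans (*-top p (p ^ˢ i) dp (^-degree p i dp)) (cong (coeff p e *_) (^-top p i dp))


module BinomialGap (F : FiniteField) where
  open FiniteField F
  open FieldFacts F
  open Poly F
  open PolynomialSemiring F
  open Degrees F
  open import Algebra.Definitions.RawSemiring (CommutativeSemiring.rawSemiring polynomialSemiring)
    using (sum) renaming (_×_ to _×ᴾ_)
  open import Algebra.Properties.CommutativeSemiring.Binomial polynomialSemiring
    using (theorem; binomialTerm)
  open ≡-Reasoning

  coeff-sum : ∀ {k} (t : Fin k → Pol) j → coeff (sum t) j ≡ sumᶠ (λ i → coeff (t i) j)
  coeff-sum {zero}  t j = refl
  coeff-sum {suc k} t j = trans (coeff-+ (t Fin.zero) (sum (t ∘ Fin.suc)) j)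
                                (cong (coeff (t Fin.zero) j +_) (coeff-sum (t ∘ Fin.suc) j))

  coeff-× : ∀ c p j → coeff (c ×ᴾ p) j ≡ c ×ᶠ coeff p j
  coeff-× zero    p j = refl
  coeff-× (suc c) p j = trans (coeff-+ p (c ×ᴾ p) j) (cong (coeff p j +_) (coeff-× c p j))

  binomialGap : ∀ {u y : Pol} {e n D s} → DegLe u e → DegLe y n → e < n → suc s ≤ D →
    (∀ i → i < s → (D C suc i) ×ᶠ 1# ≡ 0#) →
    coeff ((u +ₚ y) ^ˢ D) (weight D e n (suc s)) ≡
      coeff (y ^ˢ D) (weight D e n (suc s)) +
      (D C suc s) ×ᶠ (coeff u e ^ᶠ suc s * coeff y n ^ᶠ (D ∸ suc s))
  binomialGap {u} {y} {e} {n} {D} {s} du dy e<n s<D below = begin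
    coeff ((u +ₚ y) ^ˢ D) N                  ≡⟨ theorem D u y N ⟩
    coeff (sum (binomialTerm u y D)) N       ≡⟨ coeff-sum (binomialTerm u y D) N ⟩
    term 0 + sumᶠ {D} (term ∘ suc ∘ toℕ)     ≡⟨ cong₂ _+_ leading (sum-concentrated D (term ∘ suc) s s<D others) ⟩
    coeff (y ^ˢ D) N + term (suc s)          ≡⟨ cong (coeff (y ^ˢ D) N +_) gap ⟩
    coeff (y ^ˢ D) N + (D C suc s) ×ᶠ (coeff u e ^ᶠ suc s * coeff y n ^ᶠ (D ∸ suc s)) ∎
    where
    N : ℕ
    N = weight D e n (suc s)

    term : ℕ → Carrier
    term i = coeff ((D C i) ×ᴾ ((u ^ˢ i) *ₚ (y ^ˢ (D ∸ i)))) N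

    mixed : ℕ → Carrier
    mixed i = coeff ((u ^ˢ i) *ₚ (y ^ˢ (D ∸ i))) N

    term-shape : ∀ i → term i ≡ (D C i) ×ᶠ mixed i
    term-shape i = coeff-× (D C i) ((u ^ˢ i) *ₚ (y ^ˢ (D ∸ i))) N

    leading : term 0 ≡ coeff (y ^ˢ D) N
    leading = trans (term-shape 0) (trans (+-identityʳ _) (*-identityˡₚ (y ^ˢ D) N))

    gap : term (suc s) ≡ (D C suc s) ×ᶠ (coeff u e ^ᶠ suc s * coeff y n ^ᶠ (D ∸ suc s))
    gap = trans (term-shape (suc s)) (cong ((D C suc s) ×ᶠ_) (begin
      mixed (suc s)
        ≡⟨ *-top (u ^ˢ suc s) (y ^ˢ (D ∸ suc s)) (^-degree u (suc s) du) (^-degree y (D ∸ suc s) dy) ⟩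
      coeff (u ^ˢ suc s) (suc s ℕ.* e) * coeff (y ^ˢ (D ∸ suc s)) ((D ∸ suc s) ℕ.* n)
        ≡⟨ cong₂ _*_ (^-top u (suc s) du) (^-top y (D ∸ suc s) dy) ⟩
      coeff u e ^ᶠ suc s * coeff y n ^ᶠ (D ∸ suc s) ∎))

    -- Terms before s+1 vanish by the choice of s, terms after it by degree.
    others : ∀ i → i < D → ¬ i ≡ s → term (suc i) ≡ 0#
    others i i<D i≢s with <-cmp i s
    ... | tri< i<s _ _ = begin
      term (suc i)                           ≡⟨ term-shape (suc i) ⟩
      (D C suc i) ×ᶠ mixed (suc i)           ≡⟨ ×-as-* (D C suc i) (mixed (suc i)) ⟩
      ((D C suc i) ×ᶠ 1#) * mixed (suc i)    ≡⟨ cong (_* mixed (suc i)) (below i i<s) ⟩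
      0# * mixed (suc i)                     ≡⟨ zeroˡ (mixed (suc i)) ⟩
      0#                                     ∎
    ... | tri≈ _ i≡s _ = ⊥-elim (i≢s i≡s)
    ... | tri> _ _ s<i = begin
      term (suc i)                           ≡⟨ term-shape (suc i) ⟩
      (D C suc i) ×ᶠ mixed (suc i)           ≡⟨ cong ((D C suc i) ×ᶠ_) too-high ⟩
      (D C suc i) ×ᶠ 0#                      ≡⟨ ×-as-* (D C suc i) 0# ⟩
      ((D C suc i) ×ᶠ 1#) * 0#               ≡⟨ zeroʳ _ ⟩
      0#                                     ∎
      where
      too-high : mixed (suc i) ≡ 0#
      too-high = *-degree (u ^ˢ suc i) (y ^ˢ (D ∸ suc i))
                   (^-degree u (suc i) du) (^-degree y (D ∸ suc i) dy)
                   N (weight-decreasing e<n (s≤s s<i) i<D)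


module Uniqueness (F : FiniteField) where
  open FiniteField F
  open FieldFacts F
  open Poly F
  open PolynomialSemiring F
  open Degrees F
  open BinomialGap F
  open import Algebra.Properties.Semiring.Exp (CommutativeSemiring.semiring polynomialSemiring)
    using (^-congˡ)
  open ≡-Reasoning

  infixl 6 _-ₚ_
  _-ₚ_ : Pol → Pol → Pol
  x -ₚ y = x +ₚ map -_ y

  coeff-- : ∀ x y j → coeff (x -ₚ y) j ≡ coeff x j + - coeff y j
  coeff-- x y j = trans (coeff-+ x (map -_ y) j) (cong (coeff x j +_) (coeff-neg y j))

  difference-vanishes : ∀ x y {j} → coeff x j ≡ coeff y j → coeff (x -ₚ y) j ≡ 0#
  difference-vanishes x y {j} same = trans (coeff-- x y j) (x≈y⇒x∙y⁻¹≈ε same)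

  difference-detects : ∀ x y {j} → coeff (x -ₚ y) j ≡ 0# → coeff x j ≡ coeff y j
  difference-detects x y {j} vanishes = x∙y⁻¹≈ε⇒x≈y _ _ (trans (sym (coeff-- x y j)) vanishes)

  difference-degree : ∀ x y {n} → DegLe x n → DegLe y n → DegLe (x -ₚ y) n
  difference-degree x y dx dy i n<i = difference-vanishes x y (trans (dx i n<i) (sym (dy i n<i)))

  difference-split : ∀ x y → x ≈ₚ ((x -ₚ y) +ₚ y)
  difference-split x y j = sym (begin
    coeff ((x -ₚ y) +ₚ y) j                 ≡⟨ coeff-+ (x -ₚ y) y j ⟩
    coeff (x -ₚ y) j + coeff y j            ≡⟨ cong (_+ coeff y j) (coeff-- x y j) ⟩
    (coeff x j + - coeff y j) + coeff y j   ≡⟨ +-assoc _ _ _ ⟩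
    coeff x j + (- coeff y j + coeff y j)   ≡⟨ cong (coeff x j +_) (-‿inverseˡ (coeff y j)) ⟩
    coeff x j + 0#                          ≡⟨ +-identityʳ _ ⟩
    coeff x j                               ∎)

  leadingTerm : ∀ u {B j} → DegLe u B → ¬ coeff u j ≡ 0# →
                Σ ℕ λ e → j ≤ e × ¬ coeff u e ≡ 0# × DegLe u e
  leadingTerm u {B} du uj≢0
    with greatest (λ i → ¬ coeff u i ≡ 0#) (λ i → ¬? (coeff u i ≟ 0#)) B
                  (λ i B<i ui≢0 → ui≢0 (du i B<i)) uj≢0
  ... | e , ue≢0 , j≤e , above =
    e , j≤e , ue≢0 , λ i e<i → decidable-stable (coeff u i ≟ 0#) (above i e<i)

  -- Some C(D,i) with 1 ≤ i ≤ D is nonzero in F, namely C(D,D) = 1; take the least.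
  firstNonvanishingBinomial : ∀ D → 1 ≤ D →
    Σ ℕ λ s → suc s ≤ D × ¬ (D C suc s) ×ᶠ 1# ≡ 0# × (∀ i → i < s → (D C suc i) ×ᶠ 1# ≡ 0#)
  firstNonvanishingBinomial (suc D′) _
    with least (λ i → ¬ (suc D′ C suc i) ×ᶠ 1# ≡ 0#) (λ i → ¬? ((suc D′ C suc i) ×ᶠ 1# ≟ 0#)) {D′} CDD≢0
    where
    CDD≢0 : ¬ (suc D′ C suc D′) ×ᶠ 1# ≡ 0#
    CDD≢0 CDD≡0 = 0≢1 (sym (trans (sym (+-identityʳ 1#))
                             (trans (cong (_×ᶠ 1#) (sym (nCn≡1 (suc D′)))) CDD≡0)))
  ... | s , Cs≢0 , s≤D′ , before =
    s , s≤s s≤D′ , Cs≢0 , λ i i<s → decidable-stable (_ ≟ 0#) (before i i<s)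

  InI-agree : ∀ {f m p r} → InI f m p → InI f m r → ∀ j → m < j → coeff p j ≡ coeff r j
  InI-agree {f} {m} {p} {r} (h₁ , dh₁ , p≈) (h₂ , dh₂ , r≈) j m<j =
    trans (agrees-with-f p h₁ dh₁ p≈) (sym (agrees-with-f r h₂ dh₂ r≈))
    where
    agrees-with-f : ∀ p h → DegLe h m → p ≈ₚ (f +ₚ h) → coeff p j ≡ coeff f j
    agrees-with-f p h dh p≈f+h = begin
      coeff p j                  ≡⟨ p≈f+h j ⟩
      coeff (f +ₚ h) j           ≡⟨ coeff-+ f h j ⟩
      coeff f j + coeff h j      ≡⟨ cong (coeff f j +_) (dh j m<j) ⟩
      coeff f j + 0#             ≡⟨ +-identityʳ _ ⟩
      coeff f j                  ∎

  -- If monic x, y of degree n differ in degree j, then x - y has a leading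
  -- coefficient in some degree e with j ≤ e < n (the leading terms cancel).
  monicDifference : ∀ x y {n j} → MonicOfDeg x n → MonicOfDeg y n → ¬ coeff x j ≡ coeff y j →
    Σ ℕ λ e → j ≤ e × e < n × ¬ coeff (x -ₚ y) e ≡ 0# × DegLe (x -ₚ y) e
  monicDifference x y {n} (x-lead , x-deg) (y-lead , y-deg) differ
    with leadingTerm (x -ₚ y) (difference-degree x y x-deg y-deg) (differ ∘ difference-detects x y)
  ... | e , j≤e , ue≢0 , u-deg = e , j≤e , e<n , ue≢0 , u-deg
    where
    e<n : e < n
    e<n = ℕₚ.≤∧≢⇒< (≮⇒≥ λ n<e → ue≢0 (difference-degree x y x-deg y-deg e n<e))
                   (λ e≡n → ue≢0 (subst (λ k → coeff (x -ₚ y) k ≡ 0#) (sym e≡n)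
                                         (difference-vanishes x y (trans x-lead (sym y-lead)))))

  powersSeparate : ∀ {x y : Pol} {n m D} → 1 ≤ m → 2 ≤ D → MonicOfDeg x n → MonicOfDeg y n →
    (∀ j → j < m → coeff x j ≡ coeff y j) →
    (∀ j → m < j → coeff (x ^ₚ D) j ≡ coeff (y ^ₚ D) j) → x ≈ₚ y
  powersSeparate {x} {y} {n} {m} {D} 1≤m 2≤D x-monic y-monic low high j
    with coeff x j ≟ coeff y j
  ... | yes same  = same
  ... | no differ
    with monicDifference x y x-monic y-monic differ
       | firstNonvanishingBinomial D (≤-trans (s≤s z≤n) 2≤D)
  ... | e , j≤e , e<n , ue≢0 , u-deg | s , s<D , Cs≢0 , before =
    ⊥-elim (gap≢0 (identityʳ-unique _ _ (sym (begin
      coeff (y ^ˢ D) N                  ≡⟨ high′ ⟨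
      coeff (x ^ˢ D) N                  ≡⟨ ^-congˡ D (difference-split x y) N ⟩
      coeff (((x -ₚ y) +ₚ y) ^ˢ D) N    ≡⟨ binomialGap u-deg (proj₂ y-monic) e<n s<D before ⟩
      coeff (y ^ˢ D) N + gap            ∎))))
    where
    N : ℕ
    N = weight D e n (suc s)

    m<N : m < N
    m<N = weight-exceeds 1≤m (≤-trans (≮⇒≥ λ j<m → differ (low j j<m)) j≤e) e<n 2≤D s<D

    gap : Carrier
    gap = (D C suc s) ×ᶠ (coeff (x -ₚ y) e ^ᶠ suc s * coeff y n ^ᶠ (D ∸ suc s))

    gap≢0 : ¬ gap ≡ 0#
    gap≢0 gap≡0 =
      *-nonzero Cs≢0 (*-nonzero (^-nonzero (suc s) ue≢0) (^-nonzero (D ∸ suc s) yn≢0))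
                (trans (sym (×-as-* (D C suc s) _)) gap≡0)
      where
      yn≢0 : ¬ coeff y n ≡ 0#
      yn≢0 yn≡0 = 0≢1 (trans (sym yn≡0) (proj₁ y-monic))

    high′ : coeff (x ^ˢ D) N ≡ coeff (y ^ˢ D) N
    high′ = subst₂ (λ X Y → coeff X N ≡ coeff Y N) (^ₚ-is-^ˢ x D) (^ₚ-is-^ˢ y D) (high N m<N)


module LowCoefficients (F : FiniteField) where
  open FiniteField F
  open Poly F
  open import Function.Bundles using (Injection)

  digits : ∀ m → Pol → Fin m → Fin size
  digits m g i = Inverse.to enumeration (coeff g (toℕ i))

  lowCoefficients : ∀ m → Pol → Fin (size ^ m)
  lowCoefficients m g = funToFin (digits m g)

  lowCoefficients-injective : ∀ {m} g h → lowCoefficients m g ≡ lowCoefficients m h →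
                              ∀ j → j < m → coeff g j ≡ coeff h j
  lowCoefficients-injective {m} g h same j j<m =
    subst (λ k → coeff g k ≡ coeff h k) (toℕ-fromℕ< j<m)
      (Injection.injective (↔⇒↣ enumeration) (begin
        digits m g i                       ≡⟨ finToFun-funToFin (digits m g) i ⟨
        finToFun (lowCoefficients m g) i   ≡⟨ cong (λ k → finToFun k i) same ⟩
        finToFun (lowCoefficients m h) i   ≡⟨ finToFun-funToFin (digits m h) i ⟩
        digits m h i                       ∎))
    where
    open ≡-Reasoning
    i : Fin m
    i = fromℕ< j<m


lemmaA6 : (F : FiniteField) →
    (f : Poly.Pol F) (k m d : ℕ) → Poly.MonicOfDeg F f k → 1 ≤ m → m < k →
    (d∣k : d ∣ k) → 1 < d →
    (gs : List (Poly.Pol F)) →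
    All (λ g → Poly.MonicOfDeg F g (_∣_.quotient d∣k) × Poly.InI F f m (Poly._^ₚ_ F g d)) gs →
    AllPairs (λ g h → ¬ (Poly._≈ₚ_ F g h)) gs →
    length gs ≤ FiniteField.size F ^ m
lemmaA6 F f k m d _ 1≤m _ d∣k 1<d gs roots distinct =
  boundedByKeys (lowCoefficients m) sameLowCoefficients⇒equal roots distinct
  where
  open Poly F
  open Uniqueness F
  open LowCoefficients F
  n : ℕ
  n = _∣_.quotient d∣k

  sameLowCoefficients⇒equal : ∀ {g h} → MonicOfDeg g n × InI f m (g ^ₚ d) →
    MonicOfDeg h n × InI f m (h ^ₚ d) → lowCoefficients m g ≡ lowCoefficients m h → ¬ ¬ g ≈ₚ h
  sameLowCoefficients⇒equal {g} {h} (g-monic , g^d∈I) (h-monic , h^d∈I) same g≉h =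
    g≉h (powersSeparate {g} {h} 1≤m 1<d g-monic h-monic (lowCoefficients-injective g h same)
                        (InI-agree {f} {m} {g ^ₚ d} {h ^ₚ d} g^d∈I h^d∈I))
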